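{- Let $G$, $L$, the ordering $v_1,\dots,v_n$, $V_i$, $G_i$ and the $k$-list coloring $f_0$ of $G$ be as in the context. Let $i\in\{1,\dots,n\}$ and let $g$ be a $k$-list coloring of $G_i$ such that $f_0[V_i]$ and $g$ lie in the same connected component of $R(G_i,L)$. Then for every $j\in\{1,\dots,i-1\}$, $f_0[V_j]$ and $g[V_j]$ lie in the same connected component of $R(G_j,L)$.
   Context: A caterpillar is a tree $G$ whose vertex set partitions into $V_S$ (spine vertices) and $V_L$ (leaves) such that $G[V_S]$ is a path and each vertex of $V_L$ is adjacent to exactly one vertex of $V_S$; the two endpoints of the path $G[V_S]$ are assumed to have degree one in $G$. The vertices of $G$ are ordered $v_1,\dots,v_n$ by breadth-first search starting at an endpoint of the spine path, giving priority to leaves: when a spine vertex is visited, all its leaves are visited next, and then the next unvisited spine vertex. Let $V_i=\{v_1,\dots,v_i\}$ and $G_i=G[V_i]$. Each vertex $v$ has a list $L(v)$ of colors; a $k$-list coloring of a graph is a proper coloring $f$ with $f(v)\in L(v)$ for every vertex $v$. For a subgraph $G_i$, $R(G_i,L)$ denotes the graph whose nodes are the $k$-list colorings of $G_i$ (with the lists restricted to $V_i$), two colorings adjacent iff they differ on exactly one vertex. For a coloring $f$ of $G$ (or of $G_i$) and $j\le i$, $f[V_j]$ denotes its restriction to $V_j$. $f_0$ is a $k$-list coloring of $G$. -}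

module Defs where

open import Data.Nat using (ℕ; zero; suc; _≤_; _<_)
open import Data.Fin using (Fin; zero; suc; toℕ; inject₁; inject≤; fromℕ)
import Data.Fin as F
open import Data.Vec using (Vec; lookup; tabulate)
open import Data.List using (List; length)
open import Data.List.Membership.Propositional using (_∈_)
open import Data.List.Relation.Unary.Unique.Propositional using (Unique)
open import Data.Product using (Σ; ∃; _×_; _,_)
open import Data.Sum using (_⊎_)
open import Function using (Injective; _⇔_)
open import Relation.Binary.PropositionalEquality using (_≡_; _≢_)
open import Relation.Binary.Construct.Closure.ReflexiveTransitive using (Star)
open import Relation.Nullary using (¬_)

-- A finite simple graph on the vertex set Fin n (vertex v_{t+1} is the element t).
record SimpleGraph (n : ℕ) : Set₁ where
  field
    _~_    : Fin n → Fin n → Set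
    ~-sym  : ∀ {u v} → u ~ v → v ~ u
    ~-irr  : ∀ {u} → ¬ (u ~ u)
open SimpleGraph public

module _ {n : ℕ} (G : SimpleGraph n) where
  private
    _∼_ = SimpleGraph._~_ G

  Connected : Set
  Connected = ∀ u v → Star _∼_ u v

  record Cycle : Set where
    field
      len    : ℕ
      cyc    : Fin (suc (suc (suc len))) → Fin n
      cyc-inj : Injective _≡_ _≡_ cyc
      cyc-adj : ∀ (t : Fin (suc (suc len))) → cyc (inject₁ t) ∼ cyc (suc t)
      cyc-close : cyc (fromℕ (suc (suc len))) ∼ cyc zero

  Acyclic : Set
  Acyclic = ¬ Cycle

  IsTree : Set
  IsTree = Connected × Acyclic

  -- G is a caterpillar whose vertex order v_1,…,v_n (= 0,…,n-1) is the breadth-first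
  -- order from a spine endpoint, giving priority to leaves.
  record CaterpillarBFS : Set where
    field
      tree      : IsTree
      -- the spine path s_0, s_1, …, s_m (the vertices of V_S, in path order)
      m         : ℕ
      s         : Fin (suc m) → Fin n
      s-inj     : Injective _≡_ _≡_ s
    IsSpine : Fin n → Set
    IsSpine v = ∃ λ t → s t ≡ v
    IsLeaf : Fin n → Set
    IsLeaf v = ¬ IsSpine v
    field
      spine-path : ∀ t t' → (s t ∼ s t') ⇔ (suc (toℕ t) ≡ toℕ t' ⊎ suc (toℕ t') ≡ toℕ t)
      leaf-attach : ∀ v → IsLeaf v → ∃ λ t → s t ∼ v × (∀ t' → s t' ∼ v → t' ≡ t)
      start-deg1 : ∃ λ u → s zero ∼ u × (∀ w → s zero ∼ w → w ≡ u)
      end-deg1   : ∃ λ u → s (fromℕ m) ∼ u × (∀ w → s (fromℕ m) ∼ w → w ≡ u)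
      -- BFS order with leaf priority: v_1 = s_0, spine visited in path order,
      -- and the leaves of s_t come after s_t and before every later spine vertex.
      bfs-start : toℕ (s zero) ≡ 0
      bfs-spine : ∀ t t' → t F.< t' → s t F.< s t'
      bfs-leaf  : ∀ v t → IsLeaf v → s t ∼ v → (s t F.< v) × (∀ t' → t F.< t' → v F.< s t')

  -- A coloring of G_i = G[V_i] is a vector of length i (entry x is the colour of v_{x+1}).
  -- It is a list colouring if colours come from the lists and adjacent vertices differ.
  IsListColoring : (L : Fin n → List ℕ) (i : ℕ) → i ≤ n → Vec ℕ i → Set
  IsListColoring L i i≤n c =
    (∀ (x : Fin i) → lookup c x ∈ L (inject≤ x i≤n)) ×
    (∀ (x y : Fin i) → inject≤ x i≤n ∼ inject≤ y i≤n → lookup c x ≢ lookup c y)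

  -- Edge of the reconfiguration graph R(G_i, L): two list colourings differing on exactly one vertex.
  RStep : (L : Fin n → List ℕ) (i : ℕ) → i ≤ n → Vec ℕ i → Vec ℕ i → Set
  RStep L i i≤n c d =
    IsListColoring L i i≤n c × IsListColoring L i i≤n d ×
    (∃ λ (x : Fin i) → lookup c x ≢ lookup d x × (∀ y → y ≢ x → lookup c y ≡ lookup d y))

  SameComponent : (L : Fin n → List ℕ) (i : ℕ) → i ≤ n → Vec ℕ i → Vec ℕ i → Set
  SameComponent L i i≤n = Star (RStep L i i≤n)

restrict : ∀ {i j : ℕ} → j ≤ i → Vec ℕ i → Vec ℕ j
restrict j≤i c = tabulate (λ x → lookup c (inject≤ x j≤i))

IsKListAssignment : ∀ {n} → ℕ → (Fin n → List ℕ) → Set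
IsKListAssignment k L = ∀ v → Unique (L v) × length (L v) ≡ k

module Submission where

-- The theorem holds for every graph G and every list assignment L.  The idea: restrict
-- each colouring in a path of R(G_i, L) from f₀[V_i] to g to the subgraph
-- G_j = G[V_j].  Restriction preserves being a list colouring, and a single
-- reconfiguration step, which recolours one vertex x, becomes
--   * a single step of R(G_j, L) if x ∈ V_j, and
--   * no change at all if x ∉ V_j.
-- Hence restriction maps walks of R(G_i, L) to walks of R(G_j, L); the walk
-- starts at f₀[V_i][V_j] = f₀[V_j] and ends at g[V_j].

open import Defs
open import Data.Nat using (ℕ; _≤_; _<_)
open import Data.Nat.Properties using (≤-refl; ≤-trans; <⇒≤)
open import Data.Fin using (Fin; inject≤)
open import Data.Fin.Properties using (any?; inject≤-idempotent; inject≤-injective)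
  renaming (_≟_ to _≟ᶠ_)
open import Data.List using (List)
open import Data.List.Membership.Propositional using (_∈_)
open import Data.Vec using (Vec; lookup)
open import Data.Vec.Properties using (lookup∘tabulate; tabulate-cong)
open import Data.Product using (_,_; ∃)
open import Relation.Nullary using (yes; no; ¬_)
open import Relation.Binary.PropositionalEquality
open import Relation.Binary.Construct.Closure.ReflexiveTransitive
  using (ε; _◅_; kleisliStar)

lookup-restrict : ∀ {j i} (j≤i : j ≤ i) (c : Vec ℕ i) (x : Fin j) →
  lookup (restrict j≤i c) x ≡ lookup c (inject≤ x j≤i)
lookup-restrict j≤i c x = lookup∘tabulate _ x

restrict-restrict : ∀ {j i n} (j≤i : j ≤ i) (i≤n : i ≤ n) (f : Vec ℕ n) →
  restrict j≤i (restrict i≤n f) ≡ restrict (≤-trans j≤i i≤n) f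
restrict-restrict j≤i i≤n f = tabulate-cong λ x → begin
  lookup (restrict i≤n f) (inject≤ x j≤i)  ≡⟨ lookup-restrict i≤n f (inject≤ x j≤i) ⟩
  lookup f (inject≤ (inject≤ x j≤i) i≤n)    ≡⟨ cong (lookup f) (inject≤-idempotent x j≤i i≤n _) ⟩
  lookup f (inject≤ x (≤-trans j≤i i≤n))    ∎
  where open ≡-Reasoning

restrict-agree : ∀ {j i} (j≤i : j ≤ i) (c d : Vec ℕ i) (x : Fin i) →
  (∀ y → y ≢ x → lookup c y ≡ lookup d y) →
  ¬ (∃ λ (z : Fin j) → inject≤ z j≤i ≡ x) →
  restrict j≤i c ≡ restrict j≤i d
restrict-agree j≤i c d x agree x∉Vⱼ =
  tabulate-cong λ z → agree (inject≤ z j≤i) (λ z≡x → x∉Vⱼ (z , z≡x))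

module _ {n : ℕ} (G : SimpleGraph n) (L : Fin n → List ℕ)
         {j i : ℕ} (j≤i : j ≤ i) (i≤n : i ≤ n) where

  private
    j≤n : j ≤ n
    j≤n = ≤-trans j≤i i≤n

    inject-inject : ∀ (x : Fin j) → inject≤ (inject≤ x j≤i) i≤n ≡ inject≤ x j≤n
    inject-inject x = inject≤-idempotent x j≤i i≤n j≤n

  restrict-coloring : ∀ c → IsListColoring G L i i≤n c →
    IsListColoring G L j j≤n (restrict j≤i c)
  restrict-coloring c (in-lists , proper) = in-lists′ , proper′
    where
    in-lists′ : ∀ x → lookup (restrict j≤i c) x ∈ L (inject≤ x j≤n)
    in-lists′ x = subst₂ (λ a v → a ∈ L v)
      (sym (lookup-restrict j≤i c x)) (inject-inject x) (in-lists (inject≤ x j≤i))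

    proper′ : ∀ x y → SimpleGraph._~_ G (inject≤ x j≤n) (inject≤ y j≤n) →
      lookup (restrict j≤i c) x ≢ lookup (restrict j≤i c) y
    proper′ x y x~y same = proper (inject≤ x j≤i) (inject≤ y j≤i)
      (subst₂ (SimpleGraph._~_ G) (sym (inject-inject x)) (sym (inject-inject y)) x~y)
      (trans (sym (lookup-restrict j≤i c x)) (trans same (lookup-restrict j≤i c y)))

  restrict-step-inside : ∀ c d → RStep G L i i≤n c d → (z : Fin j) →
    lookup c (inject≤ z j≤i) ≢ lookup d (inject≤ z j≤i) →
    (∀ y → y ≢ inject≤ z j≤i → lookup c y ≡ lookup d y) →
    RStep G L j j≤n (restrict j≤i c) (restrict j≤i d)
  restrict-step-inside c d (c-col , d-col , _) z changed agree =
    restrict-coloring c c-col , restrict-coloring d d-col , z , changed′ , agree′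
    where
    changed′ : lookup (restrict j≤i c) z ≢ lookup (restrict j≤i d) z
    changed′ same = changed
      (trans (sym (lookup-restrict j≤i c z)) (trans same (lookup-restrict j≤i d z)))

    agree′ : ∀ y → y ≢ z → lookup (restrict j≤i c) y ≡ lookup (restrict j≤i d) y
    agree′ y y≢z = trans (lookup-restrict j≤i c y) (trans
      (agree (inject≤ y j≤i) (λ e → y≢z (inject≤-injective j≤i j≤i y z e)))
      (sym (lookup-restrict j≤i d y)))

  restrict-step : ∀ {c d} → RStep G L i i≤n c d →
    SameComponent G L j j≤n (restrict j≤i c) (restrict j≤i d)
  restrict-step {c} {d} step@(_ , _ , x , changed , agree)
    with any? (λ (z : Fin j) → inject≤ z j≤i ≟ᶠ x)
  ... | yes (z , refl) = restrict-step-inside c d step z changed agree ◅ ε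
  ... | no x∉Vⱼ rewrite restrict-agree j≤i c d x agree x∉Vⱼ = ε

  restrict-walk : ∀ {c d} → SameComponent G L i i≤n c d →
    SameComponent G L j j≤n (restrict j≤i c) (restrict j≤i d)
  restrict-walk = kleisliStar (restrict j≤i) (λ {c} {d} → restrict-step {c} {d})

lemma3 : ∀ (n : ℕ) (G : SimpleGraph n) → CaterpillarBFS G →
    ∀ (k : ℕ) (L : Fin n → List ℕ) → IsKListAssignment k L →
    ∀ (f₀ : Vec ℕ n) → IsListColoring G L n ≤-refl f₀ →
    ∀ (i : ℕ) → 1 ≤ i → (i≤n : i ≤ n) →
    ∀ (g : Vec ℕ i) → IsListColoring G L i i≤n g →
    SameComponent G L i i≤n (restrict i≤n f₀) g →
    ∀ (j : ℕ) → 1 ≤ j → (j<i : j < i) →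
    SameComponent G L j (≤-trans (<⇒≤ j<i) i≤n)
      (restrict (≤-trans (<⇒≤ j<i) i≤n) f₀) (restrict (<⇒≤ j<i) g)
lemma3 n G _ k L _ f₀ _ i _ i≤n g _ f₀~g j _ j<i =
  subst (λ start → SameComponent G L j (≤-trans j≤i i≤n) start (restrict j≤i g))
    (restrict-restrict j≤i i≤n f₀)
    (restrict-walk G L j≤i i≤n f₀~g)
  where
  j≤i : j ≤ i
  j≤i = <⇒≤ j<i
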